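{- For every integer $n\ge 3$ there exists a complete tripartite graph on $n$ vertices that is $S$-determined.
   Context: All graphs are finite and simple. For a graph $G$, the Seidel matrix is $S(G)=J-I-2A(G)$, where $A(G)$ is the adjacency matrix, $J$ the all-ones matrix and $I$ the identity; its eigenvalue multiset is the Seidel spectrum of $G$. For a partition $V(G)=U\cup W$, Seidel switching with respect to $U$ deletes all edges between $U$ and $W$ and adds an edge between $u\in U$, $w\in W$ whenever $uw$ was not an edge. Two graphs are switching equivalent if one is obtained from the other by a Seidel switching. A graph $G$ is $S$-determined if every graph with the same Seidel spectrum as $G$ is switching equivalent to a graph isomorphic to $G$. -}

module Defs where

open import Data.Nat using (ℕ; zero; suc)
open import Data.Bool using (Bool; true; false; _xor_; if_then_else_)
open import Data.Fin using (Fin; zero; suc; punchIn; _≟_)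
open import Data.Fin.Permutation using (Permutation′; _⟨$⟩ʳ_)
open import Data.Integer using (ℤ; _+_; _*_; _-_; -_; 0ℤ; 1ℤ; -1ℤ)
open import Data.Product using (Σ; ∃; _×_; _,_)
open import Function using (Surjective)
open import Relation.Binary.PropositionalEquality using (_≡_; _≢_)
open import Relation.Nullary using (¬_; does)

record Graph (n : ℕ) : Set where
  field
    adj    : Fin n → Fin n → Bool
    sym    : ∀ i j → adj i j ≡ adj j i
    irrefl : ∀ i → adj i i ≡ false
open Graph public

Mat : ℕ → Set
Mat n = Fin n → Fin n → ℤ

-- Seidel matrix S(G) = J - I - 2A(G): 0 on the diagonal, -1 for edges, 1 for non-edges.
seidel : ∀ {n} → Graph n → Mat n
seidel G i j with does (i ≟ j)
... | true  = 0ℤ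
... | false = if adj G i j then -1ℤ else 1ℤ

sumFin : ∀ n → (Fin n → ℤ) → ℤ
sumFin zero    f = 0ℤ
sumFin (suc n) f = f zero + sumFin n (λ k → f (suc k))

sgn : ℕ → ℤ
sgn zero    = 1ℤ
sgn (suc k) = - sgn k

det : ∀ n → Mat n → ℤ
det zero    M = 1ℤ
det (suc n) M = sumFin (suc n) (λ j →
  sgn (Data.Fin.toℕ j) * (M zero j * det n (λ r c → M (suc r) (punchIn j c))))

charPolyAt : ∀ {n} → Mat n → ℤ → ℤ
charPolyAt {n} M x = det n (λ i j → (if does (i ≟ j) then x else 0ℤ) - M i j)

-- Same Seidel spectrum: the Seidel matrices (real symmetric) have the same
-- characteristic polynomial; two integer polynomials are equal iff they agree
-- at every integer.
SameSeidelSpectrum : ∀ {n} → Graph n → Graph n → Set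
SameSeidelSpectrum G H = ∀ x → charPolyAt (seidel G) x ≡ charPolyAt (seidel H) x

-- Seidel switching with respect to U ⊆ V (U given by its indicator):
-- adjacency between U and W is complemented, the rest is unchanged.
switch : ∀ {n} → Graph n → (Fin n → Bool) → Graph n
switch {n} G U = record { adj = a ; sym = s ; irrefl = r }
  where
  a : Fin n → Fin n → Bool
  a i j = adj G i j xor (U i xor U j)
  s : ∀ i j → a i j ≡ a j i
  s i j with adj G i j | adj G j i | Graph.sym G i j | U i | U j
  ... | x | .x | Relation.Binary.PropositionalEquality.refl | true  | true  = Relation.Binary.PropositionalEquality.refl
  ... | x | .x | Relation.Binary.PropositionalEquality.refl | true  | false = Relation.Binary.PropositionalEquality.refl
  ... | x | .x | Relation.Binary.PropositionalEquality.refl | false | true  = Relation.Binary.PropositionalEquality.refl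
  ... | x | .x | Relation.Binary.PropositionalEquality.refl | false | false = Relation.Binary.PropositionalEquality.refl
  r : ∀ i → a i i ≡ false
  r i with adj G i i | Graph.irrefl G i | U i
  ... | .false | Relation.Binary.PropositionalEquality.refl | true  = Relation.Binary.PropositionalEquality.refl
  ... | .false | Relation.Binary.PropositionalEquality.refl | false = Relation.Binary.PropositionalEquality.refl

Isomorphic : ∀ {n} → Graph n → Graph n → Set
Isomorphic {n} G H = Σ (Permutation′ n) λ σ →
  ∀ i j → adj G (σ ⟨$⟩ʳ i) (σ ⟨$⟩ʳ j) ≡ adj H i j

SameGraph : ∀ {n} → Graph n → Graph n → Set
SameGraph G H = ∀ i j → adj G i j ≡ adj H i j

SwitchingEquivalent : ∀ {n} → Graph n → Graph n → Set
SwitchingEquivalent {n} H G = Σ (Fin n → Bool) λ U → SameGraph (switch H U) G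

-- G is S-determined: every graph with the same Seidel spectrum as G is
-- switching equivalent to a graph isomorphic to G.
-- (Cospectral graphs have the same number of vertices, so H ranges over Graph n.)
SDetermined : ∀ {n} → Graph n → Set
SDetermined {n} G = ∀ (H : Graph n) → SameSeidelSpectrum H G →
  Σ (Graph n) λ G′ → SwitchingEquivalent H G′ × Isomorphic G′ G

CompleteTripartite : ∀ {n} → Graph n → Set
CompleteTripartite {n} G = Σ (Fin n → Fin 3) λ part →
  Surjective _≡_ _≡_ part ×
  (∀ i j → adj G i j ≡ true → part i ≢ part j) ×
  (∀ i j → part i ≢ part j → adj G i j ≡ true)

-- The graph is K_{1,1,n-2}.  Expanding det (x I - S) along the diagonal shows that the
-- coefficient of x ^ (n - 3) is the sum of the principal 3 × 3 minors of -S; on a triangle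
-- {i, j, k} such a minor is 2 s_ij s_jk s_ik = ±2 according to the parity of its number of
-- edges, so the Seidel spectrum determines the number τ of odd triangles.  Splitting off
-- vertex 0 gives τ(G) = e(L) + τ(G - 0), where the link L joins i and j when {0, i, j} is odd
-- and has the same odd triangles as G - 0.  If G - 0 has none, L is a complete bipartite
-- graph K_{p,q} with p + q = n - 1 and τ = pq; otherwise L has an edge and induction gives
-- τ ≥ 1 + (n - 3).  So τ = 0 or τ ≥ n - 2, and the value τ = n - 2 of K_{1,1,n-2} forces L
-- to be a star or a single edge, that is, the link of a relabelled K_{1,1,n-2}.  Two graphs
-- with the same link at 0 differ by the Seidel switching at the vertices where their
-- neighbourhoods of 0 differ.

module Submission where

open import Defs hiding (sym)
open import Algebra.Bundles using (Semiring)
open import Data.Bool using (Bool; true; false; not; _∧_; _∨_; _xor_; if_then_else_)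
import Data.Bool.Properties as BoolP
open import Data.Empty using (⊥-elim)
open import Data.Fin using (Fin; zero; suc; toℕ; fromℕ<; punchIn; punchOut; _≟_; _<_)
import Data.Fin.Properties as FinP
import Data.Integer.Properties as ℤP
open import Data.Nat as ℕ using (ℕ; zero; suc; z≤n; s≤s; _≥_)
import Data.Nat.Properties as ℕP
open import Data.Product using (Σ; _×_; _,_; ∃₂)
open import Data.Sum using (_⊎_; inj₁; inj₂; [_,_]′)
open import Function using (_∘_; mk⇔)
open import Relation.Binary.PropositionalEquality
  using (_≡_; _≢_; refl; sym; trans; cong; cong₂; subst; module ≡-Reasoning)
open import Relation.Nullary using (does; yes; no)
open import Relation.Nullary.Decidable using (dec-true; dec-false; does-⇔)

module IteratedSums {c ℓ} (R : Semiring c ℓ) where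

  open Semiring R hiding (zero) renaming (refl to ≈-refl; sym to ≈-sym; trans to ≈-trans)
  open import Algebra.Properties.CommutativeSemigroup +-commutativeSemigroup using (interchange)
  open import Algebra.Properties.Semiring.Sum R public
  open import Relation.Binary.Reasoning.Setoid setoid

  Σ<₂ : ∀ m → (Fin m → Fin m → Carrier) → Carrier
  Σ<₂ zero    F = 0#
  Σ<₂ (suc m) F = sum (λ j → F zero (suc j)) + Σ<₂ m (λ i j → F (suc i) (suc j))

  Σ<₃ : ∀ m → (Fin m → Fin m → Fin m → Carrier) → Carrier
  Σ<₃ zero    F = 0#
  Σ<₃ (suc m) F = Σ<₂ m (λ i j → F zero (suc i) (suc j)) + Σ<₃ m (λ i j k → F (suc i) (suc j) (suc k))

  Σ<₂-cong : ∀ m {F G : Fin m → Fin m → Carrier} →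
    (∀ i j → i < j → F i j ≈ G i j) → Σ<₂ m F ≈ Σ<₂ m G
  Σ<₂-cong zero    e = ≈-refl
  Σ<₂-cong (suc m) e = +-cong (sum-cong-≋ (λ j → e zero (suc j) (s≤s z≤n)))
                              (Σ<₂-cong m (λ i j i<j → e (suc i) (suc j) (s≤s i<j)))

  Σ<₃-cong : ∀ m {F G : Fin m → Fin m → Fin m → Carrier} →
    (∀ i j k → i < j → j < k → F i j k ≈ G i j k) → Σ<₃ m F ≈ Σ<₃ m G
  Σ<₃-cong zero    e = ≈-refl
  Σ<₃-cong (suc m) e =
    +-cong (Σ<₂-cong m (λ j k j<k → e zero (suc j) (suc k) (s≤s z≤n) (s≤s j<k)))
           (Σ<₃-cong m (λ i j k i<j j<k → e (suc i) (suc j) (suc k) (s≤s i<j) (s≤s j<k)))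

  Σ<₂-zero : ∀ m → Σ<₂ m (λ _ _ → 0#) ≈ 0#
  Σ<₂-zero zero    = ≈-refl
  Σ<₂-zero (suc m) = ≈-trans (+-cong (sum-replicate-zero m) (Σ<₂-zero m)) (+-identityˡ 0#)

  Σ<₃-zero : ∀ m → Σ<₃ m (λ _ _ _ → 0#) ≈ 0#
  Σ<₃-zero zero    = ≈-refl
  Σ<₃-zero (suc m) = ≈-trans (+-cong (Σ<₂-zero m) (Σ<₃-zero m)) (+-identityˡ 0#)

  Σ<₂-distrib-+ : ∀ m (F G : Fin m → Fin m → Carrier) →
    Σ<₂ m (λ i j → F i j + G i j) ≈ Σ<₂ m F + Σ<₂ m G
  Σ<₂-distrib-+ zero    F G = ≈-sym (+-identityˡ 0#)
  Σ<₂-distrib-+ (suc m) F G = begin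
    sum (λ j → F zero (suc j) + G zero (suc j)) + Σ<₂ m (λ i j → F (suc i) (suc j) + G (suc i) (suc j))
      ≈⟨ +-cong (∑-distrib-+ (λ j → F zero (suc j)) (λ j → G zero (suc j))) (Σ<₂-distrib-+ m _ _) ⟩
    (sum (λ j → F zero (suc j)) + sum (λ j → G zero (suc j))) +
      (Σ<₂ m (λ i j → F (suc i) (suc j)) + Σ<₂ m (λ i j → G (suc i) (suc j)))
      ≈⟨ interchange _ _ _ _ ⟩
    Σ<₂ (suc m) F + Σ<₂ (suc m) G ∎

  Σ<₃-distrib-+ : ∀ m (F G : Fin m → Fin m → Fin m → Carrier) →
    Σ<₃ m (λ i j k → F i j k + G i j k) ≈ Σ<₃ m F + Σ<₃ m G
  Σ<₃-distrib-+ zero    F G = ≈-sym (+-identityˡ 0#)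
  Σ<₃-distrib-+ (suc m) F G =
    ≈-trans (+-cong (Σ<₂-distrib-+ m _ _) (Σ<₃-distrib-+ m _ _)) (interchange _ _ _ _)

  Σ<₂-*ˡ : ∀ m x (F : Fin m → Fin m → Carrier) → x * Σ<₂ m F ≈ Σ<₂ m (λ i j → x * F i j)
  Σ<₂-*ˡ zero    x F = zeroʳ x
  Σ<₂-*ˡ (suc m) x F = ≈-trans (distribˡ x _ _) (+-cong (*-distribˡ-sum x (λ j → F zero (suc j))) (Σ<₂-*ˡ m x _))

  Σ<₃-*ˡ : ∀ m x (F : Fin m → Fin m → Fin m → Carrier) → x * Σ<₃ m F ≈ Σ<₃ m (λ i j k → x * F i j k)
  Σ<₃-*ˡ zero    x F = zeroʳ x
  Σ<₃-*ˡ (suc m) x F = ≈-trans (distribˡ x _ _) (+-cong (Σ<₂-*ˡ m x _) (Σ<₃-*ˡ m x _))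

module Determinant where

  open import Data.Integer using (ℤ; +_; _+_; _*_; -_; _-_; _^_; 0ℤ; 1ℤ)
  open import Data.Integer.Tactic.RingSolver using (solve-∀)
  open import Data.Vec.Functional using (_∷_; [])
  open import Function using (_⇔_)
  open IteratedSums ℤP.+-*-semiring
    using (sum; Σ<₂; Σ<₃; sum-cong-≗; ∑-distrib-+; *-distribˡ-sum; sum-remove; sum-replicate-zero)
  open ≡-Reasoning

  sumFin≡sum : ∀ n (f : Fin n → ℤ) → sumFin n f ≡ sum f
  sumFin≡sum zero    f = refl
  sumFin≡sum (suc n) f = cong (_+_ (f zero)) (sumFin≡sum n (λ i → f (suc i)))

  sgn-+ : ∀ a b → sgn (a ℕ.+ b) ≡ sgn a * sgn b
  sgn-+ zero    b = sym (ℤP.*-identityˡ (sgn b))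
  sgn-+ (suc a) b = trans (cong -_ (sgn-+ a b)) (ℤP.neg-distribˡ-* (sgn a) (sgn b))

  sgn-double : ∀ a → sgn (a ℕ.+ a) ≡ 1ℤ
  sgn-double zero    = refl
  sgn-double (suc a) = begin
    sgn (suc a ℕ.+ suc a)   ≡⟨ cong (λ k → - sgn k) (ℕP.+-suc a a) ⟩
    - - sgn (a ℕ.+ a)       ≡⟨ ℤP.neg-involutive _ ⟩
    sgn (a ℕ.+ a)           ≡⟨ sgn-double a ⟩
    1ℤ                      ∎

  minor : ∀ {n} → Fin (suc n) → Fin (suc n) → Mat (suc n) → Mat n
  minor r c M i j = M (punchIn r i) (punchIn c j)

  laplaceTerm : ∀ {n} → Mat (suc n) → Fin (suc n) → ℤ
  laplaceTerm {n} M j = sgn (toℕ j) * (M zero j * det n (minor zero j M))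

  det-suc : ∀ {n} (M : Mat (suc n)) → det (suc n) M ≡ sum (laplaceTerm M)
  det-suc {n} M = sumFin≡sum (suc n) (laplaceTerm M)

  det-cong : ∀ n {M N : Mat n} → (∀ i j → M i j ≡ N i j) → det n M ≡ det n N
  det-cong zero    e = refl
  det-cong (suc n) {M} {N} e = begin
    det (suc n) M         ≡⟨ det-suc M ⟩
    sum (laplaceTerm M)   ≡⟨ sum-cong-≗ term ⟩
    sum (laplaceTerm N)   ≡⟨ det-suc N ⟨
    det (suc n) N         ∎
    where
    term : ∀ j → laplaceTerm M j ≡ laplaceTerm N j
    term j = cong₂ (λ x d → sgn (toℕ j) * (x * d)) (e zero j)
                   (det-cong n (λ i k → e (suc i) (punchIn j k)))

  det-terms-linear : ∀ {n} (A B C : Mat (suc n)) a →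
    (∀ j → laplaceTerm A j ≡ a * laplaceTerm B j + laplaceTerm C j) →
    det (suc n) A ≡ a * det (suc n) B + det (suc n) C
  det-terms-linear A B C a e = begin
    det _ A
      ≡⟨ det-suc A ⟩
    sum (laplaceTerm A)
      ≡⟨ sum-cong-≗ e ⟩
    sum (λ j → a * laplaceTerm B j + laplaceTerm C j)
      ≡⟨ ∑-distrib-+ (λ j → a * laplaceTerm B j) (laplaceTerm C) ⟩
    sum (λ j → a * laplaceTerm B j) + sum (laplaceTerm C)
      ≡⟨ cong₂ _+_ (*-distribˡ-sum a (laplaceTerm B)) (det-suc C) ⟨
    a * sum (laplaceTerm B) + det _ C
      ≡⟨ cong (λ d → a * d + det _ C) (det-suc B) ⟨
    a * det _ B + det _ C ∎

  det-linear-row : ∀ n (A B C : Mat n) (r : Fin n) (a : ℤ) →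
    (∀ i j → i ≢ r → A i j ≡ B i j) → (∀ i j → i ≢ r → A i j ≡ C i j) →
    (∀ j → A r j ≡ a * B r j + C r j) → det n A ≡ a * det n B + det n C
  det-linear-row (suc n) A B C zero a A≡B A≡C row = det-terms-linear A B C a term
    where
    distrib : ∀ a s x y d → s * ((a * x + y) * d) ≡ a * (s * (x * d)) + s * (y * d)
    distrib = solve-∀
    term : ∀ j → laplaceTerm A j ≡ a * laplaceTerm B j + laplaceTerm C j
    term j = begin
      s * (A zero j * dA)                               ≡⟨ cong (λ x → s * (x * dA)) (row j) ⟩
      s * ((a * B zero j + C zero j) * dA)              ≡⟨ distrib a s (B zero j) (C zero j) dA ⟩
      a * (s * (B zero j * dA)) + s * (C zero j * dA)   ≡⟨ cong₂ (λ d d′ → a * (s * (B zero j * d)) + s * (C zero j * d′))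
                                                                 dA≡dB dA≡dC ⟩
      a * laplaceTerm B j + laplaceTerm C j             ∎
      where
      s : ℤ
      s = sgn (toℕ j)
      dA : ℤ
      dA = det n (minor zero j A)
      dA≡dB : dA ≡ det n (minor zero j B)
      dA≡dB = det-cong n (λ i k → A≡B (suc i) (punchIn j k) λ ())
      dA≡dC : dA ≡ det n (minor zero j C)
      dA≡dC = det-cong n (λ i k → A≡C (suc i) (punchIn j k) λ ())
  det-linear-row (suc n) A B C (suc r) a A≡B A≡C row = det-terms-linear A B C a term
    where
    distrib : ∀ a s x d d′ → s * (x * (a * d + d′)) ≡ a * (s * (x * d)) + s * (x * d′)
    distrib = solve-∀
    term : ∀ j → laplaceTerm A j ≡ a * laplaceTerm B j + laplaceTerm C j
    term j = begin
      s * (A zero j * det n (minor zero j A))          ≡⟨ cong₂ (λ x d → s * (x * d)) (A≡B zero j λ ()) minors ⟩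
      s * (B zero j * (a * dB + dC))                   ≡⟨ distrib a s (B zero j) dB dC ⟩
      a * (s * (B zero j * dB)) + s * (B zero j * dC)  ≡⟨ cong (λ x → a * (s * (B zero j * dB)) + s * (x * dC)) B₀≡C₀ ⟩
      a * laplaceTerm B j + laplaceTerm C j            ∎
      where
      s : ℤ
      s = sgn (toℕ j)
      dB : ℤ
      dB = det n (minor zero j B)
      dC : ℤ
      dC = det n (minor zero j C)
      minors : det n (minor zero j A) ≡ a * dB + dC
      minors = det-linear-row n (minor zero j A) (minor zero j B) (minor zero j C) r a
                 (λ i k i≢r → A≡B (suc i) (punchIn j k) (i≢r ∘ FinP.suc-injective))
                 (λ i k i≢r → A≡C (suc i) (punchIn j k) (i≢r ∘ FinP.suc-injective))
                 (λ k → row (punchIn j k))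
      B₀≡C₀ : B zero j ≡ C zero j
      B₀≡C₀ = trans (sym (A≡B zero j λ ())) (A≡C zero j λ ())

  det-zero-row : ∀ n (A : Mat n) r → (∀ j → A r j ≡ 0ℤ) → det n A ≡ 0ℤ
  det-zero-row n A r zero-row = begin
    det n A                           ≡⟨ cancel (det n A) ⟩
    (1ℤ * det n A + det n A) - det n A ≡⟨ cong (_- det n A) (sym doubled) ⟩
    det n A - det n A                 ≡⟨ ℤP.+-inverseʳ (det n A) ⟩
    0ℤ                                ∎
    where
    cancel : ∀ d → d ≡ (1ℤ * d + d) - d
    cancel = solve-∀
    doubled : det n A ≡ 1ℤ * det n A + det n A
    doubled = det-linear-row n A A A r 1ℤ (λ _ _ _ → refl) (λ _ _ _ → refl)
                (λ j → trans (zero-row j) (cong (λ v → 1ℤ * v + v) (sym (zero-row j))))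

  punchIn-punchIn-punchOut : ∀ {n} (c : Fin (suc (suc n))) (j : Fin (suc n)) (q : punchIn c j ≢ c) (k : Fin n) →
    punchIn (punchIn c j) (punchIn (punchOut q) k) ≡ punchIn c (punchIn j k)
  punchIn-punchIn-punchOut zero          j       q k       = refl
  punchIn-punchIn-punchOut (suc c)       zero    q k       = refl
  punchIn-punchIn-punchOut {suc n} (suc c) (suc j) q zero    = refl
  punchIn-punchIn-punchOut {suc n} (suc c) (suc j) q (suc k) =
    cong suc (punchIn-punchIn-punchOut c j (q ∘ cong suc) k)

  sgn-punchIn-punchOut : ∀ {n} (c : Fin (suc (suc n))) (j : Fin (suc n)) (q : punchIn c j ≢ c) →
    sgn (toℕ (punchIn c j)) * sgn (toℕ (punchOut q)) ≡ - (sgn (toℕ c) * sgn (toℕ j))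
  sgn-punchIn-punchOut zero          j       q = flip-sign (sgn (toℕ j))
    where
    flip-sign : ∀ x → (- x) * 1ℤ ≡ - (1ℤ * x)
    flip-sign = solve-∀
  sgn-punchIn-punchOut (suc c)       zero    q = flip-sign (sgn (toℕ c))
    where
    flip-sign : ∀ x → 1ℤ * x ≡ - ((- x) * 1ℤ)
    flip-sign = solve-∀
  sgn-punchIn-punchOut {suc n} (suc c) (suc j) q = begin
    (- p) * (- o)                          ≡⟨ neg-neg p o ⟩
    p * o                                  ≡⟨ sgn-punchIn-punchOut c j (q ∘ cong suc) ⟩
    - (sgn (toℕ c) * sgn (toℕ j))          ≡⟨ cong -_ (neg-neg (sgn (toℕ c)) (sgn (toℕ j))) ⟨
    - ((- sgn (toℕ c)) * (- sgn (toℕ j)))  ∎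
    where
    p : ℤ
    p = sgn (toℕ (punchIn c j))
    o : ℤ
    o = sgn (toℕ (punchOut (q ∘ cong suc)))
    neg-neg : ∀ x y → (- x) * (- y) ≡ x * y
    neg-neg = solve-∀

  sgn-cofactor : ∀ {n} r (c : Fin (suc (suc n))) (k : Fin (suc n)) x D →
    sgn (toℕ (punchIn c k)) * (x * (sgn (r ℕ.+ toℕ (punchOut (FinP.punchInᵢ≢i c k))) * D))
      ≡ sgn (suc r ℕ.+ toℕ c) * (sgn (toℕ k) * (x * D))
  sgn-cofactor {n} r c k x D = begin
    p * (x * (sgn (r ℕ.+ toℕ po) * D))
      ≡⟨ cong (λ z → p * (x * (z * D))) (sgn-+ r (toℕ po)) ⟩
    p * (x * (sgn r * o * D))
      ≡⟨ regroup p x (sgn r) o D ⟩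
    p * o * (sgn r * (x * D))
      ≡⟨ cong (_* (sgn r * (x * D))) (sgn-punchIn-punchOut c k q) ⟩
    - (sgn (toℕ c) * sgn (toℕ k)) * (sgn r * (x * D))
      ≡⟨ regroup′ (sgn (toℕ c)) (sgn (toℕ k)) (sgn r) x D ⟩
    - (sgn r * sgn (toℕ c)) * (sgn (toℕ k) * (x * D))
      ≡⟨ cong (λ z → - z * (sgn (toℕ k) * (x * D))) (sgn-+ r (toℕ c)) ⟨
    sgn (suc r ℕ.+ toℕ c) * (sgn (toℕ k) * (x * D)) ∎
    where
    q : punchIn c k ≢ c
    q = FinP.punchInᵢ≢i c k
    po : Fin (suc n)
    po = punchOut q
    p : ℤ
    p = sgn (toℕ (punchIn c k))
    o : ℤ
    o = sgn (toℕ po)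
    regroup : ∀ p x r o D → p * (x * (r * o * D)) ≡ p * o * (r * (x * D))
    regroup = solve-∀
    regroup′ : ∀ c k r x D → - (c * k) * (r * (x * D)) ≡ - (r * c) * (k * (x * D))
    regroup′ = solve-∀

  det-unit-row : ∀ n (M : Mat (suc n)) (r c : Fin (suc n)) →
    M r c ≡ 1ℤ → (∀ k → k ≢ c → M r k ≡ 0ℤ) →
    det (suc n) M ≡ sgn (toℕ r ℕ.+ toℕ c) * det n (minor r c M)
  det-unit-row n M zero c unit off-unit = begin
    det (suc n) M
      ≡⟨ det-suc M ⟩
    sum (laplaceTerm M)
      ≡⟨ sum-remove {i = c} (laplaceTerm M) ⟩
    laplaceTerm M c + sum (λ k → laplaceTerm M (punchIn c k))
      ≡⟨ cong₂ _+_ (cong (λ x → s * (x * d)) unit) (trans (sum-cong-≗ vanish) (sum-replicate-zero n)) ⟩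
    s * (1ℤ * d) + 0ℤ
      ≡⟨ simplify s d ⟩
    s * d ∎
    where
    s : ℤ
    s = sgn (toℕ c)
    d : ℤ
    d = det n (minor zero c M)
    simplify : ∀ s d → s * (1ℤ * d) + 0ℤ ≡ s * d
    simplify = solve-∀
    vanish : ∀ k → laplaceTerm M (punchIn c k) ≡ 0ℤ
    vanish k = trans (cong (λ x → sgn (toℕ (punchIn c k)) * (x * det n (minor zero (punchIn c k) M)))
                           (off-unit (punchIn c k) (FinP.punchInᵢ≢i c k)))
                     (annihilate (sgn (toℕ (punchIn c k))) (det n (minor zero (punchIn c k) M)))
      where
      annihilate : ∀ s d → s * (0ℤ * d) ≡ 0ℤ
      annihilate = solve-∀
  det-unit-row (suc n) M (suc r) c unit off-unit = begin
    det (suc (suc n)) M                              ≡⟨ det-suc M ⟩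
    sum (laplaceTerm M)                              ≡⟨ sum-remove {i = c} (laplaceTerm M) ⟩
    laplaceTerm M c + sum (λ k → laplaceTerm M (punchIn c k))
                                                     ≡⟨ cong₂ _+_ column-c (sum-cong-≗ other-column) ⟩
    0ℤ + sum (λ k → S * laplaceTerm M′ k)            ≡⟨ ℤP.+-identityˡ _ ⟩
    sum (λ k → S * laplaceTerm M′ k)                 ≡⟨ *-distribˡ-sum S (laplaceTerm M′) ⟨
    S * sum (laplaceTerm M′)                         ≡⟨ cong (S *_) (det-suc M′) ⟨
    S * det (suc n) M′                               ∎
    where
    M′ : Mat (suc n)
    M′ = minor (suc r) c M
    S : ℤ
    S = sgn (suc (toℕ r) ℕ.+ toℕ c)
    column-c : laplaceTerm M c ≡ 0ℤ
    column-c = trans (cong (λ d → sgn (toℕ c) * (M zero c * d))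
                           (det-zero-row (suc n) (minor zero c M) r
                             (λ k → off-unit (punchIn c k) (FinP.punchInᵢ≢i c k))))
                     (annihilate (sgn (toℕ c)) (M zero c))
      where
      annihilate : ∀ s x → s * (x * 0ℤ) ≡ 0ℤ
      annihilate = solve-∀
    other-column : ∀ k → laplaceTerm M (punchIn c k) ≡ S * laplaceTerm M′ k
    other-column k = trans (cong (λ d → sgn (toℕ pk) * (M zero pk * d)) row-r)
                           (sgn-cofactor (toℕ r) c k (M zero pk) (det n (minor zero k M′)))
      where
      pk : Fin (suc (suc n))
      pk = punchIn c k
      q : pk ≢ c
      q = FinP.punchInᵢ≢i c k
      po : Fin (suc n)
      po = punchOut q
      row-r : det (suc n) (minor zero pk M) ≡ sgn (toℕ r ℕ.+ toℕ po) * det n (minor zero k M′)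
      row-r = trans
        (det-unit-row n (minor zero pk M) r po
          (trans (cong (M (suc r)) (FinP.punchIn-punchOut q)) unit)
          (λ k′ k′≢po → off-unit (punchIn pk k′)
             (λ e → k′≢po (FinP.punchIn-injective pk k′ po (trans e (sym (FinP.punchIn-punchOut q)))))))
        (cong (sgn (toℕ r ℕ.+ toℕ po) *_)
          (det-cong n (λ i l → cong (M (suc (punchIn r i))) (punchIn-punchIn-punchOut c k q l))))

  addDiagFrom : ∀ {n} → ℕ → ℤ → Mat n → Mat n
  addDiagFrom h x M i j = (if does (i ≟ j) ∧ does (h ℕ.≤? toℕ i) then x else 0ℤ) + M i j

  ≤-punchIn⇔ : ∀ {n} (p : Fin (suc n)) (i : Fin n) → toℕ p ℕ.≤ toℕ (punchIn p i) ⇔ toℕ p ℕ.≤ toℕ i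
  ≤-punchIn⇔ zero    i       = mk⇔ (λ _ → z≤n) (λ _ → z≤n)
  ≤-punchIn⇔ (suc p) zero    = mk⇔ (λ le → le) (λ le → le)
  ≤-punchIn⇔ (suc p) (suc i) = mk⇔ (s≤s ∘ to ∘ ℕ.s≤s⁻¹) (s≤s ∘ from ∘ ℕ.s≤s⁻¹)
    where open Function.Equivalence (≤-punchIn⇔ p i)

  unitRow : ∀ {n} → Fin n → Mat n → Mat n
  unitRow p A i j = if does (i ≟ p) then (if does (j ≟ p) then 1ℤ else 0ℤ) else A i j

  det-unitRow : ∀ n (A : Mat (suc n)) p → det (suc n) (unitRow p A) ≡ det n (minor p p A)
  det-unitRow n A p = begin
    det (suc n) (unitRow p A)
      ≡⟨ det-unit-row n (unitRow p A) p p unit off-unit ⟩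
    sgn (toℕ p ℕ.+ toℕ p) * det n (minor p p (unitRow p A))
      ≡⟨ cong (_* det n (minor p p (unitRow p A))) (sgn-double (toℕ p)) ⟩
    1ℤ * det n (minor p p (unitRow p A))
      ≡⟨ ℤP.*-identityˡ _ ⟩
    det n (minor p p (unitRow p A))
      ≡⟨ det-cong n same-minor ⟩
    det n (minor p p A) ∎
    where
    unit : unitRow p A p p ≡ 1ℤ
    unit rewrite dec-true (p ≟ p) refl = refl
    off-unit : ∀ k → k ≢ p → unitRow p A p k ≡ 0ℤ
    off-unit k k≢p rewrite dec-true (p ≟ p) refl | dec-false (k ≟ p) k≢p = refl
    same-minor : ∀ i k → minor p p (unitRow p A) i k ≡ minor p p A i k
    same-minor i k rewrite dec-false (punchIn p i ≟ p) (FinP.punchInᵢ≢i p i) = refl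

  minor-addDiagFrom : ∀ {n} (M : Mat (suc n)) p x i k →
    minor p p (addDiagFrom (toℕ p) x M) i k ≡ addDiagFrom (toℕ p) x (minor p p M) i k
  minor-addDiagFrom M p x i k with i ≟ k
  ... | yes refl rewrite dec-true (punchIn p i ≟ punchIn p i) refl
                       | does-⇔ (≤-punchIn⇔ p i) (toℕ p ℕ.≤? toℕ (punchIn p i)) (toℕ p ℕ.≤? toℕ i) = refl
  ... | no i≢k rewrite dec-false (punchIn p i ≟ punchIn p k) (i≢k ∘ FinP.punchIn-injective p i k) = refl

  -- Row p is x times the unit row plus the same row with the slot at p removed.
  det-addDiagFrom-expand : ∀ n (M : Mat (suc n)) (p : Fin (suc n)) x →
    det (suc n) (addDiagFrom (toℕ p) x M) ≡
      x * det n (addDiagFrom (toℕ p) x (minor p p M)) + det (suc n) (addDiagFrom (suc (toℕ p)) x M)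
  det-addDiagFrom-expand n M p x =
    trans (det-linear-row (suc n) A B C p x A≡B A≡C row-p)
          (cong (λ d → x * d + det (suc n) C)
                (trans (det-unitRow n A p) (det-cong n (minor-addDiagFrom M p x))))
    where
    h : ℕ
    h = toℕ p
    A : Mat (suc n)
    A = addDiagFrom h x M
    B : Mat (suc n)
    B = unitRow p A
    C : Mat (suc n)
    C = addDiagFrom (suc h) x M
    A≡B : ∀ i j → i ≢ p → A i j ≡ B i j
    A≡B i j i≢p rewrite dec-false (i ≟ p) i≢p = refl
    A≡C : ∀ i j → i ≢ p → A i j ≡ C i j
    A≡C i j i≢p = cong (λ b → (if does (i ≟ j) ∧ b then x else 0ℤ) + M i j)
      (does-⇔ (mk⇔ (λ h≤i → ℕP.≤∧≢⇒< h≤i (λ e → i≢p (FinP.toℕ-injective (sym e)))) ℕP.<⇒≤)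
                  (h ℕ.≤? toℕ i) (suc h ℕ.≤? toℕ i))
    row-p : ∀ j → A p j ≡ x * B p j + C p j
    row-p j with j ≟ p
    ... | yes refl rewrite dec-true (j ≟ j) refl | dec-true (h ℕ.≤? h) ℕP.≤-refl
                         | dec-false (suc h ℕ.≤? h) (ℕP.n≮n h) = diagonal x (M j j)
      where
      diagonal : ∀ x m → x + m ≡ x * 1ℤ + (0ℤ + m)
      diagonal = solve-∀
    ... | no j≢p rewrite dec-true (p ≟ p) refl | dec-false (p ≟ j) (j≢p ∘ sym) = off-diagonal x (M p j)
      where
      off-diagonal : ∀ x m → 0ℤ + m ≡ x * 0ℤ + (0ℤ + m)
      off-diagonal = solve-∀

  firstSlot : ∀ n m → Fin (suc n)
  firstSlot n m = fromℕ< (s≤s (ℕP.m∸n≤m n m))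

  toℕ-firstSlot : ∀ n m → toℕ (firstSlot n m) ≡ n ℕ.∸ m
  toℕ-firstSlot n m = FinP.toℕ-fromℕ< _

  firstSlot-offset : ∀ k m → firstSlot (k ℕ.+ m) m ≡ fromℕ< (s≤s (ℕP.m≤m+n k m))
  firstSlot-offset k m = FinP.toℕ-injective
    (trans (toℕ-firstSlot (k ℕ.+ m) m) (trans (ℕP.m+n∸n≡m k m) (sym (FinP.toℕ-fromℕ< _))))

  -- The coefficient of x ^ (m ∸ t) in det (addDiagFrom (n ∸ m) x M) (see eval-coeff), computed by
  -- expanding along the first diagonal entry that carries x.
  coeff : ∀ n → ℕ → Mat n → ℕ → ℤ
  coeff n       zero    M zero    = det n M
  coeff n       zero    M (suc t) = 0ℤ
  coeff zero    (suc m) M t       = 0ℤ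
  coeff (suc n) (suc m) M zero    = coeff n m (minor (firstSlot n m) (firstSlot n m) M) zero
  coeff (suc n) (suc m) M (suc t) =
    coeff n m (minor (firstSlot n m) (firstSlot n m) M) (suc t) + coeff (suc n) m M t

  coeff-high : ∀ n m M t → m ℕ.< t → coeff n m M t ≡ 0ℤ
  coeff-high n       zero    M (suc t) _         = refl
  coeff-high zero    (suc m) M t       _         = refl
  coeff-high (suc n) (suc m) M (suc t) (s≤s m<t) =
    cong₂ _+_ (coeff-high n m _ (suc t) (ℕP.m≤n⇒m≤1+n m<t)) (coeff-high (suc n) m M t m<t)

  eval : ℕ → (ℕ → ℤ) → ℤ → ℤ
  eval zero    c x = c zero
  eval (suc m) c x = c zero * x ^ suc m + eval m (c ∘ suc) x

  eval-cong : ∀ m {c d : ℕ → ℤ} x → (∀ t → c t ≡ d t) → eval m c x ≡ eval m d x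
  eval-cong zero    x e = e zero
  eval-cong (suc m) x e = cong₂ _+_ (cong (_* x ^ suc m) (e zero)) (eval-cong m x (e ∘ suc))

  eval-+ : ∀ m (c d : ℕ → ℤ) x → eval m (λ t → c t + d t) x ≡ eval m c x + eval m d x
  eval-+ zero    c d x = refl
  eval-+ (suc m) c d x = trans (cong (λ e → (c zero + d zero) * x ^ suc m + e) (eval-+ m (c ∘ suc) (d ∘ suc) x))
                               (regroup (c zero) (d zero) (x ^ suc m) _ _)
    where
    regroup : ∀ a b p u v → (a + b) * p + (u + v) ≡ a * p + u + (b * p + v)
    regroup = solve-∀

  eval-neg : ∀ m (c : ℕ → ℤ) x → eval m (λ t → - c t) x ≡ - eval m c x
  eval-neg zero    c x = refl
  eval-neg (suc m) c x = trans (cong (λ e → (- c zero) * x ^ suc m + e) (eval-neg m (c ∘ suc) x))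
                               (negate (c zero) (x ^ suc m) _)
    where
    negate : ∀ a p e → (- a) * p + (- e) ≡ - (a * p + e)
    negate = solve-∀

  eval-zero : ∀ m c x → (∀ t → t ℕ.≤ m → c t ≡ 0ℤ) → eval m c x ≡ 0ℤ
  eval-zero zero    c x z = z zero z≤n
  eval-zero (suc m) c x z =
    cong₂ _+_ (trans (cong (_* x ^ suc m) (z zero z≤n)) (ℤP.*-zeroˡ (x ^ suc m)))
              (eval-zero m (c ∘ suc) x (λ t t≤m → z (suc t) (s≤s t≤m)))

  eval-suc-lowest-zero : ∀ m c x → c (suc m) ≡ 0ℤ → eval (suc m) c x ≡ x * eval m c x
  eval-suc-lowest-zero zero    c x e rewrite e = lowest (c zero) x
    where
    lowest : ∀ a x → a * (x * 1ℤ) + 0ℤ ≡ x * a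
    lowest = solve-∀
  eval-suc-lowest-zero (suc m) c x e =
    trans (cong (λ e → c zero * x ^ suc (suc m) + e) (eval-suc-lowest-zero m (c ∘ suc) x e))
          (factor-x (c zero) x (x ^ suc m) _)
    where
    factor-x : ∀ a x p e → a * (x * p) + x * e ≡ x * (a * p + e)
    factor-x = solve-∀

  shift : (ℕ → ℤ) → ℕ → ℤ
  shift d zero    = 0ℤ
  shift d (suc t) = d t

  eval-shift : ∀ m d x → eval (suc m) (shift d) x ≡ eval m d x
  eval-shift m d x = trans (cong (_+ eval m d x) (ℤP.*-zeroˡ (x ^ suc m))) (ℤP.+-identityˡ _)

  coeff-split : ∀ n m M t → coeff (suc n) (suc m) M t ≡
    coeff n m (minor (firstSlot n m) (firstSlot n m) M) t + shift (coeff (suc n) m M) t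
  coeff-split n m M zero    = sym (ℤP.+-identityʳ _)
  coeff-split n m M (suc t) = refl

  eval-coeff : ∀ n m (M : Mat n) x → m ℕ.≤ n → eval m (coeff n m M) x ≡ det n (addDiagFrom (n ℕ.∸ m) x M)
  eval-coeff n zero M x _ = det-cong n no-slot
    where
    no-slot : ∀ i j → M i j ≡ addDiagFrom n x M i j
    no-slot i j = sym (trans (cong (λ b → (if does (i ≟ j) ∧ b then x else 0ℤ) + M i j)
                                   (dec-false (n ℕ.≤? toℕ i) (ℕP.<⇒≱ (FinP.toℕ<n i))))
                      (trans (cong (λ b → (if b then x else 0ℤ) + M i j) (BoolP.∧-zeroʳ (does (i ≟ j))))
                             (ℤP.+-identityˡ (M i j))))
  eval-coeff (suc n) (suc m) M x (s≤s m≤n) = begin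
    eval (suc m) (coeff (suc n) (suc m) M) x
      ≡⟨ eval-cong (suc m) x (coeff-split n m M) ⟩
    eval (suc m) (λ t → coeff n m Mp t + shift (coeff (suc n) m M) t) x
      ≡⟨ eval-+ (suc m) (coeff n m Mp) (shift (coeff (suc n) m M)) x ⟩
    eval (suc m) (coeff n m Mp) x + eval (suc m) (shift (coeff (suc n) m M)) x
      ≡⟨ cong₂ _+_ (eval-suc-lowest-zero m (coeff n m Mp) x (coeff-high n m Mp (suc m) (ℕP.n<1+n m)))
                   (eval-shift m _ x) ⟩
    x * eval m (coeff n m Mp) x + eval m (coeff (suc n) m M) x
      ≡⟨ cong₂ _+_ (cong (x *_) (eval-coeff n m Mp x m≤n)) (eval-coeff (suc n) m M x (ℕP.m≤n⇒m≤1+n m≤n)) ⟩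
    x * det n (addDiagFrom (n ℕ.∸ m) x Mp) + det (suc n) (addDiagFrom (suc n ℕ.∸ m) x M)
      ≡⟨ cong₂ (λ h h′ → x * det n (addDiagFrom h x Mp) + det (suc n) (addDiagFrom h′ x M)) p≡ suc-p≡ ⟨
    x * det n (addDiagFrom (toℕ p) x Mp) + det (suc n) (addDiagFrom (suc (toℕ p)) x M)
      ≡⟨ det-addDiagFrom-expand n M p x ⟨
    det (suc n) (addDiagFrom (toℕ p) x M)
      ≡⟨ cong (λ h → det (suc n) (addDiagFrom h x M)) p≡ ⟩
    det (suc n) (addDiagFrom (n ℕ.∸ m) x M) ∎
    where
    p : Fin (suc n)
    p = firstSlot n m
    p≡ : toℕ p ≡ n ℕ.∸ m
    p≡ = toℕ-firstSlot n m
    suc-p≡ : suc (toℕ p) ≡ suc n ℕ.∸ m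
    suc-p≡ = trans (cong suc p≡) (sym (ℕP.+-∸-assoc 1 m≤n))
    Mp : Mat n
    Mp = minor p p M

  charPoly-eval : ∀ n (M : Mat n) x → charPolyAt M x ≡ eval n (coeff n n (λ i j → - M i j)) x
  charPoly-eval n M x = sym (trans (eval-coeff n n _ x ℕP.≤-refl) (det-cong n entry))
    where
    entry : ∀ i j → addDiagFrom (n ℕ.∸ n) x (λ i j → - M i j) i j ≡ (if does (i ≟ j) then x else 0ℤ) - M i j
    entry i j rewrite ℕP.n∸n≡0 n with does (i ≟ j)
    ... | true  = refl
    ... | false = refl

  hornerStep : (ℕ → ℤ) → ℤ → ℕ → ℤ
  hornerStep c y zero    = c zero * y + c 1
  hornerStep c y (suc t) = c (suc (suc t))

  -- the quotient of synthetic division by x - y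
  quotient : ℕ → (ℕ → ℤ) → ℤ → ℕ → ℤ
  quotient zero    c y t       = c zero
  quotient (suc m) c y zero    = c zero
  quotient (suc m) c y (suc t) = quotient m (hornerStep c y) y t

  quotient-leading : ∀ m c y → quotient m c y zero ≡ c zero
  quotient-leading zero    c y = refl
  quotient-leading (suc m) c y = refl

  eval-factor : ∀ m c x y → eval (suc m) c x ≡ (x - y) * eval m (quotient m c y) x + eval (suc m) c y
  eval-factor zero c x y = linear (c zero) (c 1) x y
    where
    linear : ∀ a b x y → a * (x * 1ℤ) + b ≡ (x - y) * a + (a * (y * 1ℤ) + b)
    linear = solve-∀
  eval-factor (suc m) c x y = begin
    c zero * (x * P) + (c 1 * P + R)
      ≡⟨ peel (c zero) (c 1) x y P R ⟩
    (x - y) * (c zero * P) + (eval (suc m) (hornerStep c y) x)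
      ≡⟨ cong (λ e → (x - y) * (c zero * P) + e) (eval-factor m (hornerStep c y) x y) ⟩
    (x - y) * (c zero * P) + ((x - y) * Q + ((c zero * y + c 1) * Py + Ry))
      ≡⟨ collect (c zero) (c 1) x y P Py Q Ry ⟩
    (x - y) * (c zero * P + Q) + (c zero * (y * Py) + (c 1 * Py + Ry)) ∎
    where
    P : ℤ
    P = x ^ suc m
    Py : ℤ
    Py = y ^ suc m
    R : ℤ
    R = eval m (λ t → c (suc (suc t))) x
    Ry : ℤ
    Ry = eval m (λ t → c (suc (suc t))) y
    Q : ℤ
    Q = eval m (quotient m (hornerStep c y) y) x
    peel : ∀ c₀ c₁ x y P R → c₀ * (x * P) + (c₁ * P + R) ≡ (x - y) * (c₀ * P) + ((c₀ * y + c₁) * P + R)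
    peel = solve-∀
    collect : ∀ c₀ c₁ x y P Py Q Ry →
      (x - y) * (c₀ * P) + ((x - y) * Q + ((c₀ * y + c₁) * Py + Ry)) ≡
      (x - y) * (c₀ * P + Q) + (c₀ * (y * Py) + (c₁ * Py + Ry))
    collect = solve-∀

  eval-root : ∀ m c y → eval (suc m) c y ≡ 0ℤ → ∀ x → eval (suc m) c x ≡ (x - y) * eval m (quotient m c y) x
  eval-root m c y root x = begin
    eval (suc m) c x                                       ≡⟨ eval-factor m c x y ⟩
    (x - y) * eval m (quotient m c y) x + eval (suc m) c y  ≡⟨ cong (_+_ ((x - y) * eval m (quotient m c y) x)) root ⟩
    (x - y) * eval m (quotient m c y) x + 0ℤ                ≡⟨ ℤP.+-identityʳ _ ⟩
    (x - y) * eval m (quotient m c y) x                     ∎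

  eval-leading-zero : ∀ m c x → c zero ≡ 0ℤ → eval (suc m) c x ≡ eval m (c ∘ suc) x
  eval-leading-zero m c x c₀≡0 = begin
    c zero * x ^ suc m + eval m (c ∘ suc) x   ≡⟨ cong (λ a → a * x ^ suc m + eval m (c ∘ suc) x) c₀≡0 ⟩
    0ℤ * x ^ suc m + eval m (c ∘ suc) x       ≡⟨ cong (_+ eval m (c ∘ suc) x) (ℤP.*-zeroˡ (x ^ suc m)) ⟩
    0ℤ + eval m (c ∘ suc) x                   ≡⟨ ℤP.+-identityˡ _ ⟩
    eval m (c ∘ suc) x                        ∎

  -- Dividing by x - B leaves a quotient that vanishes at every k > B.
  eval-vanishing : ∀ m c B → (∀ k → B ℕ.≤ k → eval m c (+ k) ≡ 0ℤ) → ∀ t → t ℕ.≤ m → c t ≡ 0ℤ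
  eval-vanishing zero    c B vanish zero z≤n = vanish B ℕP.≤-refl
  eval-vanishing (suc m) c B vanish = coefficient
    where
    y : ℤ
    y = + B
    q : ℕ → ℤ
    q = quotient m c y
    divides : ∀ x → eval (suc m) c x ≡ (x - y) * eval m q x
    divides = eval-root m c y (vanish B ℕP.≤-refl)
    q-vanishes : ∀ k → suc B ℕ.≤ k → eval m q (+ k) ≡ 0ℤ
    q-vanishes k B<k with ℤP.i*j≡0⇒i≡0∨j≡0 (+ k - y) (trans (sym (divides (+ k))) (vanish k (ℕP.<⇒≤ B<k)))
    ... | inj₁ k-B≡0 = ⊥-elim (ℕP.<-irrefl (ℤP.+-injective (sym (ℤP.i-j≡0⇒i≡j (+ k) y k-B≡0))) B<k)
    ... | inj₂ q≡0   = q≡0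
    q-zero : ∀ t → t ℕ.≤ m → q t ≡ 0ℤ
    q-zero = eval-vanishing m q (suc B) q-vanishes
    c-vanishes : ∀ x → eval (suc m) c x ≡ 0ℤ
    c-vanishes x = trans (divides x)
      (trans (cong ((x - y) *_) (eval-zero m q x q-zero)) (ℤP.*-zeroʳ (x - y)))
    leading : c zero ≡ 0ℤ
    leading = trans (sym (quotient-leading m c y)) (q-zero zero z≤n)
    coefficient : ∀ t → t ℕ.≤ suc m → c t ≡ 0ℤ
    coefficient zero    _         = leading
    coefficient (suc t) (s≤s t≤m) = eval-vanishing m (c ∘ suc) 0
      (λ k _ → trans (sym (eval-leading-zero m c (+ k) leading)) (c-vanishes (+ k))) t t≤m

  eval-injective : ∀ m c d → (∀ x → eval m c x ≡ eval m d x) → ∀ t → t ℕ.≤ m → c t ≡ d t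
  eval-injective m c d same t t≤m =
    ℤP.i-j≡0⇒i≡j (c t) (d t) (eval-vanishing m (λ t → c t - d t) 0 difference t t≤m)
    where
    difference : ∀ k → 0 ℕ.≤ k → eval m (λ t → c t - d t) (+ k) ≡ 0ℤ
    difference k _ = begin
      eval m (λ t → c t - d t) (+ k)                ≡⟨ eval-+ m c (λ t → - d t) (+ k) ⟩
      eval m c (+ k) + eval m (λ t → - d t) (+ k)   ≡⟨ cong₂ _+_ (same (+ k)) (eval-neg m d (+ k)) ⟩
      eval m d (+ k) - eval m d (+ k)               ≡⟨ ℤP.+-inverseʳ (eval m d (+ k)) ⟩
      0ℤ                                            ∎

  principal₃ : ∀ {n} → Mat n → Fin n → Fin n → Fin n → ℤ
  principal₃ M a b c = det 3 (λ u v → M ((a ∷ b ∷ c ∷ []) u) ((a ∷ b ∷ c ∷ []) v))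

  -- coeff-fixedₖ: with the indices 0, …, k - 1 kept off the diagonal slots, coefficient 3 - k
  -- is the sum of the principal 3-minors containing all of them.
  coeff-fixed₃ : ∀ m (M : Mat (3 ℕ.+ m)) →
    coeff (3 ℕ.+ m) m M 0 ≡ principal₃ M zero (suc zero) (suc (suc zero))
  coeff-fixed₃ zero    M = refl
  coeff-fixed₃ (suc m) M rewrite firstSlot-offset 3 m = coeff-fixed₃ m M₃
    where
    M₃ : Mat (3 ℕ.+ m)
    M₃ = minor (suc (suc (suc zero))) (suc (suc (suc zero))) M

  coeff-fixed₂ : ∀ m (M : Mat (2 ℕ.+ m)) →
    coeff (2 ℕ.+ m) m M 1 ≡ sum (λ k → principal₃ M zero (suc zero) (suc (suc k)))
  coeff-fixed₂ zero    M = refl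
  coeff-fixed₂ (suc m) M rewrite firstSlot-offset 2 m =
    trans (ℤP.+-comm (coeff (2 ℕ.+ m) m M₂ 1) (coeff (3 ℕ.+ m) m M 0))
          (cong₂ _+_ (coeff-fixed₃ m M) (coeff-fixed₂ m M₂))
    where
    M₂ : Mat (suc (suc m))
    M₂ = minor (suc (suc zero)) (suc (suc zero)) M

  coeff-fixed₁ : ∀ m (M : Mat (1 ℕ.+ m)) →
    coeff (1 ℕ.+ m) m M 2 ≡ Σ<₂ m (λ j k → principal₃ M zero (suc j) (suc k))
  coeff-fixed₁ zero    M = refl
  coeff-fixed₁ (suc m) M rewrite firstSlot-offset 1 m =
    trans (ℤP.+-comm (coeff (1 ℕ.+ m) m M₁ 2) (coeff (2 ℕ.+ m) m M 1))
          (cong₂ _+_ (coeff-fixed₂ m M) (coeff-fixed₁ m M₁))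
    where
    M₁ : Mat (suc m)
    M₁ = minor (suc zero) (suc zero) M

  coeff-three : ∀ m (M : Mat m) → coeff m m M 3 ≡ Σ<₃ m (principal₃ M)
  coeff-three zero    M = refl
  coeff-three (suc m) M rewrite firstSlot-offset 0 m =
    trans (ℤP.+-comm (coeff m m M₀ 3) (coeff (1 ℕ.+ m) m M 2))
          (cong₂ _+_ (coeff-fixed₁ m M) (coeff-three m M₀))
    where
    M₀ : Mat m
    M₀ = minor zero zero M

module ℕΣ = IteratedSums ℕP.+-*-semiring

parity : ∀ {n} → Graph n → Fin n → Fin n → Fin n → Bool
parity G i j k = adj G i j xor (adj G j k xor adj G i k)

bit : Bool → ℕ
bit true  = 1
bit false = 0

oddCount : ∀ {n} → Graph n → ℕ
oddCount {n} G = ℕΣ.Σ<₃ n (λ i j k → bit (parity G i j k))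

module SeidelInvariant where

  open Determinant
  open import Algebra.Properties.AbelianGroup ℤP.+-0-abelianGroup using (∙-cancelʳ)
  open import Data.Integer using (ℤ; +_; _+_; _*_; -_; _-_; 0ℤ; 1ℤ; -1ℤ)
  open import Data.Vec.Functional using (_∷_; [])
  module ℤΣ = IteratedSums ℤP.+-*-semiring
  open ≡-Reasoning

  sign : Bool → ℤ
  sign true  = 1ℤ
  sign false = -1ℤ

  hollow : ℤ → ℤ → ℤ → Mat 3
  hollow x y z zero             zero             = 0ℤ
  hollow x y z zero             (suc zero)       = x
  hollow x y z zero             (suc (suc zero)) = z
  hollow x y z (suc zero)       zero             = x
  hollow x y z (suc zero)       (suc zero)       = 0ℤ
  hollow x y z (suc zero)       (suc (suc zero)) = y
  hollow x y z (suc (suc zero)) zero             = z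
  hollow x y z (suc (suc zero)) (suc zero)       = y
  hollow x y z (suc (suc zero)) (suc (suc zero)) = 0ℤ

  det-hollow-sign : ∀ p q r → det 3 (hollow (sign p) (sign q) (sign r)) ≡ + 4 * + bit (p xor (q xor r)) - + 2
  det-hollow-sign true  true  true  = refl
  det-hollow-sign true  true  false = refl
  det-hollow-sign true  false true  = refl
  det-hollow-sign true  false false = refl
  det-hollow-sign false true  true  = refl
  det-hollow-sign false true  false = refl
  det-hollow-sign false false true  = refl
  det-hollow-sign false false false = refl

  negSeidel : ∀ {n} → Graph n → Mat n
  negSeidel G i j = - seidel G i j

  negSeidel-diag : ∀ {n} (G : Graph n) i → negSeidel G i i ≡ 0ℤ
  negSeidel-diag G i rewrite dec-true (i ≟ i) refl = refl

  negSeidel-off : ∀ {n} (G : Graph n) i j → i ≢ j → negSeidel G i j ≡ sign (adj G i j)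
  negSeidel-off G i j i≢j rewrite dec-false (i ≟ j) i≢j with adj G i j
  ... | true  = refl
  ... | false = refl

  principal₃-negSeidel : ∀ {n} (G : Graph n) a b c → a ≢ b → b ≢ c → a ≢ c →
    principal₃ (negSeidel G) a b c ≡ + 4 * + bit (parity G a b c) - + 2
  principal₃-negSeidel G a b c a≢b b≢c a≢c =
    trans (det-cong 3 entry) (det-hollow-sign (adj G a b) (adj G b c) (adj G a c))
    where
    off : ∀ i j → i ≢ j → negSeidel G j i ≡ sign (adj G i j)
    off i j i≢j = trans (negSeidel-off G j i (i≢j ∘ sym)) (cong sign (Graph.sym G j i))
    entry : ∀ u v → negSeidel G ((a ∷ b ∷ c ∷ []) u) ((a ∷ b ∷ c ∷ []) v)
                  ≡ hollow (sign (adj G a b)) (sign (adj G b c)) (sign (adj G a c)) u v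
    entry zero             zero             = negSeidel-diag G a
    entry zero             (suc zero)       = negSeidel-off G a b a≢b
    entry zero             (suc (suc zero)) = negSeidel-off G a c a≢c
    entry (suc zero)       zero             = off a b a≢b
    entry (suc zero)       (suc zero)       = negSeidel-diag G b
    entry (suc zero)       (suc (suc zero)) = negSeidel-off G b c b≢c
    entry (suc (suc zero)) zero             = off a c a≢c
    entry (suc (suc zero)) (suc zero)       = off b c b≢c
    entry (suc (suc zero)) (suc (suc zero)) = negSeidel-diag G c

  sum-pos : ∀ m (f : Fin m → ℕ) → ℤΣ.sum (λ i → + f i) ≡ + ℕΣ.sum f
  sum-pos zero    f = refl
  sum-pos (suc m) f = trans (cong (_+_ (+ f zero)) (sum-pos m (f ∘ suc))) (sym (ℤP.pos-+ (f zero) _))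

  Σ<₂-pos : ∀ m (F : Fin m → Fin m → ℕ) → ℤΣ.Σ<₂ m (λ i j → + F i j) ≡ + ℕΣ.Σ<₂ m F
  Σ<₂-pos zero    F = refl
  Σ<₂-pos (suc m) F = trans (cong₂ _+_ (sum-pos m _) (Σ<₂-pos m _))
    (sym (ℤP.pos-+ (ℕΣ.sum (λ j → F zero (suc j))) (ℕΣ.Σ<₂ m (λ i j → F (suc i) (suc j)))))

  Σ<₃-pos : ∀ m (F : Fin m → Fin m → Fin m → ℕ) → ℤΣ.Σ<₃ m (λ i j k → + F i j k) ≡ + ℕΣ.Σ<₃ m F
  Σ<₃-pos zero    F = refl
  Σ<₃-pos (suc m) F = trans (cong₂ _+_ (Σ<₂-pos m _) (Σ<₃-pos m _))
    (sym (ℤP.pos-+ (ℕΣ.Σ<₂ m (λ i j → F zero (suc i) (suc j)))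
                   (ℕΣ.Σ<₃ m (λ i j k → F (suc i) (suc j) (suc k)))))

  seidel-coeff-three : ∀ {n} (G : Graph n) →
    coeff n n (negSeidel G) 3 ≡ + 4 * + oddCount G + ℤΣ.Σ<₃ n (λ _ _ _ → - + 2)
  seidel-coeff-three {n} G = begin
    coeff n n (negSeidel G) 3
      ≡⟨ coeff-three n (negSeidel G) ⟩
    ℤΣ.Σ<₃ n (principal₃ (negSeidel G))
      ≡⟨ ℤΣ.Σ<₃-cong n (λ i j k i<j j<k → principal₃-negSeidel G i j k
                          (FinP.<⇒≢ i<j) (FinP.<⇒≢ j<k) (FinP.<⇒≢ (FinP.<-trans i<j j<k))) ⟩
    ℤΣ.Σ<₃ n (λ i j k → + 4 * + bit (parity G i j k) + - + 2)
      ≡⟨ ℤΣ.Σ<₃-distrib-+ n _ _ ⟩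
    ℤΣ.Σ<₃ n (λ i j k → + 4 * + bit (parity G i j k)) + ℤΣ.Σ<₃ n (λ _ _ _ → - + 2)
      ≡⟨ cong (_+ ℤΣ.Σ<₃ n (λ _ _ _ → - + 2)) (ℤΣ.Σ<₃-*ˡ n (+ 4) _) ⟨
    + 4 * ℤΣ.Σ<₃ n (λ i j k → + bit (parity G i j k)) + ℤΣ.Σ<₃ n (λ _ _ _ → - + 2)
      ≡⟨ cong (λ s → + 4 * s + ℤΣ.Σ<₃ n (λ _ _ _ → - + 2)) (Σ<₃-pos n _) ⟩
    + 4 * + oddCount G + ℤΣ.Σ<₃ n (λ _ _ _ → - + 2) ∎

  oddCount-spectral : ∀ {n} (H G : Graph n) → SameSeidelSpectrum H G → 3 ℕ.≤ n → oddCount H ≡ oddCount G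
  oddCount-spectral {n} H G same 3≤n =
    ℤP.+-injective (ℤP.*-cancelˡ-≡ (+ 4) _ _ (∙-cancelʳ (ℤΣ.Σ<₃ n (λ _ _ _ → - + 2)) _ _
      (trans (sym (seidel-coeff-three H)) (trans coeff₃ (seidel-coeff-three G)))))
    where
    coeff₃ : coeff n n (negSeidel H) 3 ≡ coeff n n (negSeidel G) 3
    coeff₃ = eval-injective n _ _
      (λ x → trans (sym (charPoly-eval n (seidel H) x)) (trans (same x) (charPoly-eval n (seidel G) x))) 3 3≤n

module TwoGraph where

  open import Data.Fin.Permutation as Perm using (Permutation′; _⟨$⟩ʳ_; _⟨$⟩ˡ_; insert; insert-punchIn)
  open import Data.Maybe using (just; nothing)
  open import Data.Nat using (_+_; _*_; _≤_; _∸_)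
  open import Data.Nat.Tactic.RingSolver using (solve-∀)
  open import Level using (0ℓ)
  open import Relation.Binary.Definitions using (tri<; tri≈; tri>)
  open import Tactic.RingSolver.Core.AlmostCommutativeRing using (AlmostCommutativeRing; fromCommutativeRing)
  open ℕΣ using (sum; Σ<₂; Σ<₃; Σ<₂-cong; Σ<₃-cong; Σ<₃-zero; sum-replicate-zero)

  xorRing : AlmostCommutativeRing 0ℓ 0ℓ
  xorRing = fromCommutativeRing BoolP.xor-∧-commutativeRing λ { false → just refl ; true → nothing }

  open import Tactic.RingSolver.NonReflective xorRing using (solve; _⊜_; _⊕_; Κ)

  bit≡0 : ∀ {b} → bit b ≡ 0 → b ≡ false
  bit≡0 {false} _ = refl

  xor₃≡true : ∀ a b c → a xor (b xor c) ≡ true → a ≡ true ⊎ b ≡ true ⊎ c ≡ true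
  xor₃≡true true  b     c     _ = inj₁ refl
  xor₃≡true false true  c     _ = inj₂ (inj₁ refl)
  xor₃≡true false false true  _ = inj₂ (inj₂ refl)

  term≤sum : ∀ {m} (f : Fin m → ℕ) i → f i ≤ sum f
  term≤sum f zero    = ℕP.m≤m+n _ _
  term≤sum f (suc i) = ℕP.≤-trans (term≤sum (f ∘ suc) i) (ℕP.m≤n+m _ _)

  Σ<₂-term≤ : ∀ {m} (F : Fin m → Fin m → ℕ) {i j} → i < j → F i j ≤ Σ<₂ m F
  Σ<₂-term≤ F {zero}  {suc j} _         = ℕP.≤-trans (term≤sum (λ k → F zero (suc k)) j) (ℕP.m≤m+n _ _)
  Σ<₂-term≤ F {suc i} {suc j} (s≤s i<j) = ℕP.≤-trans (Σ<₂-term≤ (λ k l → F (suc k) (suc l)) i<j) (ℕP.m≤n+m _ _)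

  sum-bit≡0 : ∀ {m} (f : Fin m → Bool) → sum (λ i → bit (f i)) ≡ 0 → ∀ i → f i ≡ false
  sum-bit≡0 f e zero    = bit≡0 (ℕP.m+n≡0⇒m≡0 _ e)
  sum-bit≡0 f e (suc i) = sum-bit≡0 (f ∘ suc) (ℕP.m+n≡0⇒n≡0 (bit (f zero)) e) i

  Σ<₂-bit≡0 : ∀ {m} (B : Fin m → Fin m → Bool) → Σ<₂ m (λ i j → bit (B i j)) ≡ 0 →
    ∀ i j → i < j → B i j ≡ false
  Σ<₂-bit≡0 B e zero    (suc j) _         = sum-bit≡0 (λ k → B zero (suc k)) (ℕP.m+n≡0⇒m≡0 _ e) j
  Σ<₂-bit≡0 B e (suc i) (suc j) (s≤s i<j) =
    Σ<₂-bit≡0 (λ k l → B (suc k) (suc l)) (ℕP.m+n≡0⇒n≡0 _ e) i j i<j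

  sum-bit≡1 : ∀ {m} (f : Fin m → Bool) → sum (λ i → bit (f i)) ≡ 1 →
    Σ (Fin m) λ u → ∀ i → f i ≡ does (i ≟ u)
  sum-bit≡1 {suc m} f e with f zero in f₀
  ... | true  = zero , λ { zero → f₀ ; (suc i) → sum-bit≡0 (f ∘ suc) (ℕP.suc-injective e) i }
  ... | false with sum-bit≡1 (f ∘ suc) e
  ...   | u , f≡ = suc u , λ { zero → f₀ ; (suc i) → f≡ i }

  Σ<₂-bit≡1 : ∀ {m} (B : Fin m → Fin m → Bool) → Σ<₂ m (λ i j → bit (B i j)) ≡ 1 →
    ∃₂ λ c x → c < x × ∀ i j → i < j → B i j ≡ does (i ≟ c) ∧ does (j ≟ x)
  Σ<₂-bit≡1 {suc m} B e with sum (λ j → bit (B zero (suc j))) in first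
  ... | suc (suc _) = ⊥-elim (ℕP.1+n≢0 (ℕP.suc-injective e))
  ... | 0 with c , x , c<x , edge ← Σ<₂-bit≡1 (λ k l → B (suc k) (suc l)) e
    = suc c , suc x , s≤s c<x , edge′
    where
    edge′ : ∀ i j → i < j → B i j ≡ does (i ≟ suc c) ∧ does (j ≟ suc x)
    edge′ zero    (suc j) _         = sum-bit≡0 (λ k → B zero (suc k)) first j
    edge′ (suc i) (suc j) (s≤s i<j) = edge i j i<j
  Σ<₂-bit≡1 {suc m} B e | 1 with u , B₀≡ ← sum-bit≡1 (λ j → B zero (suc j)) first
    = zero , suc u , s≤s z≤n , edge
    where
    edge : ∀ i j → i < j → B i j ≡ does (i ≟ zero) ∧ does (j ≟ suc u)
    edge zero    (suc j) _         = B₀≡ j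
    edge (suc i) (suc j) (s≤s i<j) = Σ<₂-bit≡0 (λ k l → B (suc k) (suc l)) (ℕP.suc-injective e) i j i<j

  sum-bit-witness : ∀ {m} (f : Fin m → Bool) → 1 ≤ sum (λ i → bit (f i)) → Σ (Fin m) λ i → f i ≡ true
  sum-bit-witness {suc m} f pos with f zero in f₀
  ... | true  = zero , f₀
  ... | false with sum-bit-witness (f ∘ suc) pos
  ...   | i , fi = suc i , fi

  Σ<₂-bit-witness : ∀ {m} (B : Fin m → Fin m → Bool) → 1 ≤ Σ<₂ m (λ i j → bit (B i j)) →
    ∃₂ λ i j → i < j × B i j ≡ true
  Σ<₂-bit-witness {suc m} B pos with sum (λ j → bit (B zero (suc j))) in first
  ... | suc _ with sum-bit-witness (λ j → B zero (suc j)) (ℕP.≤-trans (s≤s z≤n) (ℕP.≤-reflexive (sym first)))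
  ...   | j , B₀j = zero , suc j , s≤s z≤n , B₀j
  Σ<₂-bit-witness {suc m} B pos | zero with Σ<₂-bit-witness (λ k l → B (suc k) (suc l)) pos
  ...   | i , j , i<j , Bij = suc i , suc j , s≤s i<j , Bij

  Σ<₃-bit-witness : ∀ {m} (B : Fin m → Fin m → Fin m → Bool) → 1 ≤ Σ<₃ m (λ i j k → bit (B i j k)) →
    Σ (Fin m) λ i → ∃₂ λ j k → i < j × j < k × B i j k ≡ true
  Σ<₃-bit-witness {suc m} B pos with Σ<₂ m (λ j k → bit (B zero (suc j) (suc k))) in first
  ... | suc _ with Σ<₂-bit-witness (λ j k → B zero (suc j) (suc k)) (ℕP.≤-trans (s≤s z≤n) (ℕP.≤-reflexive (sym first)))
  ...   | j , k , j<k , B₀jk = zero , suc j , suc k , s≤s z≤n , s≤s j<k , B₀jk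
  Σ<₃-bit-witness {suc m} B pos | zero with Σ<₃-bit-witness (λ i j k → B (suc i) (suc j) (suc k)) pos
  ...   | i , j , k , i<j , j<k , Bijk = suc i , suc j , suc k , s≤s i<j , s≤s j<k , Bijk

  count : ∀ {m} → (Fin m → Bool) → ℕ
  count σ = sum (λ i → bit (σ i))

  count+count-not : ∀ {m} (σ : Fin m → Bool) → count σ + count (not ∘ σ) ≡ m
  count+count-not {zero}  σ = refl
  count+count-not {suc m} σ with σ zero
  ... | true  = cong suc (count+count-not (σ ∘ suc))
  ... | false = trans (ℕP.+-suc _ _) (cong suc (count+count-not (σ ∘ suc)))

  cut-size : ∀ {m} (σ : Fin m → Bool) → Σ<₂ m (λ i j → bit (σ i xor σ j)) ≡ count σ * count (not ∘ σ)
  cut-size {zero}  σ = refl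
  cut-size {suc m} σ with σ zero
  ... | true  = cong (count (not ∘ σ ∘ suc) +_) (cut-size (σ ∘ suc))
  ... | false = trans (cong (count (σ ∘ suc) +_) (cut-size (σ ∘ suc)))
                      (sym (ℕP.*-suc (count (σ ∘ suc)) (count (not ∘ σ ∘ suc))))

  product-lowerBound : ∀ {m} p q → p + q ≡ suc (suc m) → p * q ≡ 0 ⊎ suc m ≤ p * q
  product-lowerBound zero    q       _ = inj₁ refl
  product-lowerBound (suc p) zero    _ = inj₁ (ℕP.*-zeroʳ p)
  product-lowerBound {m} (suc p) (suc q) e = inj₂ (s≤s (begin
    m                ≡⟨ ℕP.suc-injective (trans (sym (ℕP.+-suc p q)) (ℕP.suc-injective e)) ⟨
    p + q            ≡⟨ ℕP.+-comm p q ⟩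
    q + p            ≤⟨ ℕP.+-monoʳ-≤ q (ℕP.m≤m*n p (suc q)) ⟩
    q + p * suc q    ∎))
    where open ℕP.≤-Reasoning

  +≡suc*⇒≡1 : ∀ p q → p + q ≡ suc (p * q) → p ≡ 1 ⊎ q ≡ 1
  +≡suc*⇒≡1 zero          q             e = inj₂ e
  +≡suc*⇒≡1 (suc zero)    q             e = inj₁ refl
  +≡suc*⇒≡1 (suc (suc p)) zero          e = ⊥-elim (ℕP.1+n≢0 (trans (ℕP.suc-injective e) (ℕP.*-zeroʳ p)))
  +≡suc*⇒≡1 (suc (suc p)) (suc zero)    e = inj₂ refl
  +≡suc*⇒≡1 (suc (suc p)) (suc (suc q)) e = ⊥-elim (ℕP.m+1+n≢m (2 + p + (2 + q)) (sym (trans e (product p q))))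
    where
    product : ∀ p q → suc ((2 + p) * (2 + q)) ≡ (2 + p + (2 + q)) + suc (p + q + p * q)
    product = solve-∀

  product-extremal : ∀ {m} p q → p + q ≡ suc (suc m) → p * q ≡ suc m → p ≡ 1 ⊎ q ≡ 1
  product-extremal p q sum≡ product≡ = +≡suc*⇒≡1 p q (trans sum≡ (cong suc (sym product≡)))

  tight-sum⇒≡1 : ∀ {a b m} → 1 ≤ a → m ≤ b → a + b ≡ suc m → a ≡ 1
  tight-sum⇒≡1 {suc zero}    _ _   _ = refl
  tight-sum⇒≡1 {suc (suc a)} _ m≤b e =
    ⊥-elim (ℕP.<-irrefl refl (ℕP.≤-trans (s≤s (ℕP.≤-trans m≤b (ℕP.m≤n+m _ a)))
                                         (ℕP.≤-reflexive (ℕP.suc-injective e))))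

  deleteZero : ∀ {n} → Graph (suc n) → Graph n
  deleteZero G = record
    { adj    = λ i j → adj G (suc i) (suc j)
    ; sym    = λ i j → Graph.sym G (suc i) (suc j)
    ; irrefl = λ i → irrefl G (suc i)
    }

  link : ∀ {n} → Graph (suc n) → Fin n → Fin n → Bool
  link G i j = parity G zero (suc i) (suc j)

  linkCount : ∀ {n} → Graph (suc n) → ℕ
  linkCount {n} G = Σ<₂ n (λ i j → bit (link G i j))

  oddCount-suc : ∀ {n} (G : Graph (suc n)) → oddCount G ≡ linkCount G + oddCount (deleteZero G)
  oddCount-suc G = refl

  -- Every edge occurs twice in the four triangles of {0, i, j, k}.
  parity-deleteZero : ∀ {n} (G : Graph (suc n)) i j k →
    parity (deleteZero G) i j k ≡ link G i j xor (link G j k xor link G i k)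
  parity-deleteZero G i j k =
    four (adj G zero (suc i)) (adj G zero (suc j)) (adj G zero (suc k))
         (adj G (suc i) (suc j)) (adj G (suc j) (suc k)) (adj G (suc i) (suc k))
    where
    four : ∀ a b c x y z → x xor (y xor z) ≡ (a xor (x xor b)) xor ((b xor (y xor c)) xor (a xor (z xor c)))
    four = solve 6 (λ a b c x y z → (x ⊕ (y ⊕ z)) ⊜ ((a ⊕ (x ⊕ b)) ⊕ ((b ⊕ (y ⊕ c)) ⊕ (a ⊕ (z ⊕ c))))) refl

  IsCut : ∀ {n} → (Fin n → Fin n → Bool) → (Fin n → Bool) → Set
  IsCut {n} L σ = ∀ (i j : Fin n) → i < j → L i j ≡ σ i xor σ j

  IsCut-not : ∀ {n} {L : Fin n → Fin n → Bool} {σ} → IsCut L σ → IsCut L (not ∘ σ)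
  IsCut-not {σ = σ} cut i j i<j = trans (cut i j i<j) (sym (BoolP.xor-annihilates-not (σ i) (σ j)))

  linkSide : ∀ {m} → Graph (suc (suc m)) → Fin (suc m) → Bool
  linkSide G zero    = false
  linkSide G (suc j) = link G zero (suc j)

  even⇒cutLink : ∀ {m} (G : Graph (suc (suc m))) → oddCount (deleteZero G) ≡ 0 → IsCut (link G) (linkSide G)
  even⇒cutLink G even zero    (suc j) _         = refl
  even⇒cutLink G even (suc i) (suc j) (s≤s i<j) = begin
    Lij                                         ≡⟨ isolate L₀i Lij L₀j ⟩
    (L₀i xor (Lij xor L₀j)) xor (L₀i xor L₀j)   ≡⟨ cong (_xor (L₀i xor L₀j)) even-triangle ⟩
    L₀i xor L₀j                                 ∎
    where
    open ≡-Reasoning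
    L₀i : Bool
    L₀i = link G zero (suc i)
    L₀j : Bool
    L₀j = link G zero (suc j)
    Lij : Bool
    Lij = link G (suc i) (suc j)
    isolate : ∀ p q r → q ≡ (p xor (q xor r)) xor (p xor r)
    isolate = solve 3 (λ p q r → q ⊜ ((p ⊕ (q ⊕ r)) ⊕ (p ⊕ r))) refl
    even-triangle : L₀i xor (Lij xor L₀j) ≡ false
    even-triangle = trans (sym (parity-deleteZero G zero (suc i) (suc j)))
      (Σ<₂-bit≡0 (λ k l → parity (deleteZero G) zero (suc k) (suc l)) (ℕP.m+n≡0⇒m≡0 _ even) i j i<j)

  cutLink⇒oddCount : ∀ {n} (G : Graph (suc n)) {σ} → IsCut (link G) σ → oddCount G ≡ count σ * count (not ∘ σ)
  cutLink⇒oddCount {n} G {σ} cut = begin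
    oddCount G                               ≡⟨ oddCount-suc G ⟩
    linkCount G + oddCount (deleteZero G)    ≡⟨ cong₂ _+_ (Σ<₂-cong n (λ i j i<j → cong bit (cut i j i<j)))
                                                          (trans (Σ<₃-cong n even-triangle) (Σ<₃-zero n)) ⟩
    Σ<₂ n (λ i j → bit (σ i xor σ j)) + 0    ≡⟨ ℕP.+-identityʳ _ ⟩
    Σ<₂ n (λ i j → bit (σ i xor σ j))        ≡⟨ cut-size σ ⟩
    count σ * count (not ∘ σ)                ∎
    where
    open ≡-Reasoning
    cancel : ∀ p q r → (p xor q) xor ((q xor r) xor (p xor r)) ≡ false
    cancel = solve 3 (λ p q r → ((p ⊕ q) ⊕ ((q ⊕ r) ⊕ (p ⊕ r))) ⊜ Κ false) refl
    even-triangle : ∀ i j k → i < j → j < k → bit (parity (deleteZero G) i j k) ≡ 0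
    even-triangle i j k i<j j<k = cong bit (begin
      parity (deleteZero G) i j k                          ≡⟨ parity-deleteZero G i j k ⟩
      link G i j xor (link G j k xor link G i k)           ≡⟨ cong₂ _xor_ (cut i j i<j)
                                                                (cong₂ _xor_ (cut j k j<k) (cut i k (FinP.<-trans i<j j<k))) ⟩
      (σ i xor σ j) xor ((σ j xor σ k) xor (σ i xor σ k))  ≡⟨ cancel (σ i) (σ j) (σ k) ⟩
      false                                                ∎)

  linkEdge⇒linkCount : ∀ {n} (G : Graph (suc n)) {i j} → i < j → link G i j ≡ true → 1 ≤ linkCount G
  linkEdge⇒linkCount G i<j edge =
    ℕP.≤-trans (ℕP.≤-reflexive (cong bit (sym edge))) (Σ<₂-term≤ (λ k l → bit (link G k l)) i<j)

  oddTriangle⇒linkEdge : ∀ {n} (G : Graph (suc n)) → 1 ≤ oddCount (deleteZero G) → 1 ≤ linkCount G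
  oddTriangle⇒linkEdge G pos
    with i , j , k , i<j , j<k , odd ← Σ<₃-bit-witness (parity (deleteZero G)) pos
    = [ linkEdge⇒linkCount G i<j
      , [ linkEdge⇒linkCount G j<k , linkEdge⇒linkCount G (FinP.<-trans i<j j<k) ]′ ]′
      (xor₃≡true (link G i j) (link G j k) (link G i k) (trans (sym (parity-deleteZero G i j k)) odd))

  link-dichotomy : ∀ {m} (G : Graph (suc (suc m))) →
    IsCut (link G) (linkSide G) ⊎ (1 ≤ oddCount (deleteZero G) × 1 ≤ linkCount G)
  link-dichotomy G with oddCount (deleteZero G) in odd
  ... | zero  = inj₁ (even⇒cutLink G odd)
  ... | suc _ = inj₂ (s≤s z≤n , oddTriangle⇒linkEdge G (ℕP.≤-trans (s≤s z≤n) (ℕP.≤-reflexive (sym odd))))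

  oddCount-lowerBound-step : ∀ {m} (G : Graph (3 + m)) →
    IsCut (link G) (linkSide G) ⊎ (1 ≤ oddCount (deleteZero G) × 1 ≤ linkCount G) →
    oddCount (deleteZero G) ≡ 0 ⊎ m ≤ oddCount (deleteZero G) →
    oddCount G ≡ 0 ⊎ suc m ≤ oddCount G
  oddCount-lowerBound-step {m} G (inj₁ cut) _ =
    subst (λ τ → τ ≡ 0 ⊎ suc m ≤ τ) (sym (cutLink⇒oddCount G {linkSide G} cut))
          (product-lowerBound (count (linkSide G)) (count (not ∘ linkSide G)) (count+count-not (linkSide G)))
  oddCount-lowerBound-step G (inj₂ (odd≥1 , link≥1)) (inj₁ even) = ⊥-elim (ℕP.<⇒≢ odd≥1 (sym even))
  oddCount-lowerBound-step G (inj₂ (odd≥1 , link≥1)) (inj₂ m≤τ)  = inj₂ (ℕP.+-mono-≤ link≥1 m≤τ)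

  oddCount-lowerBound : ∀ {n} (G : Graph n) → oddCount G ≡ 0 ⊎ n ∸ 2 ≤ oddCount G
  oddCount-lowerBound {zero}              G = inj₂ z≤n
  oddCount-lowerBound {suc zero}          G = inj₂ z≤n
  oddCount-lowerBound {suc (suc zero)}    G = inj₂ z≤n
  oddCount-lowerBound {suc (suc (suc m))} G =
    oddCount-lowerBound-step G (link-dichotomy G) (oddCount-lowerBound (deleteZero G))

  does-sym : ∀ {n} (v w : Fin n) → does (v ≟ w) ≡ does (w ≟ v)
  does-sym v w = does-⇔ (mk⇔ sym sym) (v ≟ w) (w ≟ v)

  isApex : ∀ {n} → Fin n → Fin n → Fin n → Bool
  isApex a b v = does (v ≟ a) ∨ does (v ≟ b)

  -- K_{1,1,n-2}, with singleton parts {a} and {b}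
  K₁₁ : ∀ {n} → Fin n → Fin n → Graph n
  K₁₁ a b = record
    { adj    = λ v w → (isApex a b v ∨ isApex a b w) ∧ not (does (v ≟ w))
    ; sym    = λ v w → cong₂ _∧_ (BoolP.∨-comm (isApex a b v) (isApex a b w)) (cong not (does-sym v w))
    ; irrefl = λ v → trans (cong (λ d → (isApex a b v ∨ isApex a b v) ∧ not d) (dec-true (v ≟ v) refl))
                           (BoolP.∧-zeroʳ _)
    }

  link-K₁₁-star : ∀ {n} (u i j : Fin n) → i ≢ j → link (K₁₁ zero (suc u)) i j ≡ does (i ≟ u) xor does (j ≟ u)
  link-K₁₁-star u i j i≢j rewrite dec-false (i ≟ j) i≢j
                                | BoolP.∧-identityʳ (does (i ≟ u) ∨ does (j ≟ u)) with i ≟ u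
  ... | yes refl rewrite dec-false (j ≟ i) (i≢j ∘ sym) = refl
  ... | no _     = flip (does (j ≟ u))
    where
    flip : ∀ b → true xor (b xor true) ≡ false xor b
    flip true  = refl
    flip false = refl

  link-K₁₁-edge : ∀ {n} {c x i j : Fin n} → c < x → i < j →
    link (K₁₁ (suc c) (suc x)) i j ≡ does (i ≟ c) ∧ does (j ≟ x)
  link-K₁₁-edge {c = c} {x} {i} {j} c<x i<j
    rewrite dec-false (i ≟ j) (FinP.<⇒≢ i<j)
          | BoolP.∧-identityʳ (isApex c x i)
          | BoolP.∧-identityʳ (isApex c x j)
          | BoolP.∧-identityʳ (isApex c x i ∨ isApex c x j)
    = trans (xor-∨ (isApex c x i) (isApex c x j)) apexes
    where
    xor-∨ : ∀ a b → a xor ((a ∨ b) xor b) ≡ a ∧ b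
    xor-∨ true  true  = refl
    xor-∨ true  false = refl
    xor-∨ false b     = BoolP.xor-same b
    apexes : isApex c x i ∧ isApex c x j ≡ does (i ≟ c) ∧ does (j ≟ x)
    apexes with i ≟ c
    ... | yes refl rewrite dec-false (j ≟ i) (FinP.<⇒≢ i<j ∘ sym) = refl
    ... | no _ with i ≟ x
    ...   | yes refl rewrite dec-false (j ≟ c) (FinP.<⇒≢ (FinP.<-trans c<x i<j) ∘ sym)
                           | dec-false (j ≟ i) (FinP.<⇒≢ i<j ∘ sym) = refl
    ...   | no _ = refl

  SameLink : ∀ {n} → Graph (suc n) → Graph (suc n) → Set
  SameLink {n} G H = ∀ (i j : Fin n) → i < j → link G i j ≡ link H i j

  star⇒sameLink : ∀ {m} (G : Graph (suc (suc m))) {σ} → IsCut (link G) σ → count σ ≡ 1 →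
    Σ (Fin (suc m)) λ u → SameLink G (K₁₁ zero (suc u))
  star⇒sameLink G {σ} cut single with sum-bit≡1 σ single
  ... | u , σ≡ = u , λ i j i<j → trans (cut i j i<j)
                   (trans (cong₂ _xor_ (σ≡ i) (σ≡ j)) (sym (link-K₁₁-star u i j (FinP.<⇒≢ i<j))))

  edge⇒sameLink : ∀ {n} (G : Graph (suc n)) → linkCount G ≡ 1 →
    ∃₂ λ c x → c < x × SameLink G (K₁₁ (suc c) (suc x))
  edge⇒sameLink G single with Σ<₂-bit≡1 (link G) single
  ... | c , x , c<x , edge = c , x , c<x , λ i j i<j → trans (edge i j i<j) (sym (link-K₁₁-edge c<x i<j))

  HasK₁₁Link : ∀ {n} → Graph (suc n) → Set
  HasK₁₁Link G = ∃₂ λ a b → a ≢ b × SameLink G (K₁₁ a b)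

  oddCount-extremal : ∀ {m} (G : Graph (3 + m)) → oddCount G ≡ suc m → HasK₁₁Link G
  oddCount-extremal {m} G τ≡ = [ cut-case , odd-case ]′ (link-dichotomy G)
    where
    centred : (Σ (Fin (suc (suc m))) λ u → SameLink G (K₁₁ zero (suc u))) → HasK₁₁Link G
    centred (u , same) = zero , suc u , (λ ()) , same
    cut-case : IsCut (link G) (linkSide G) → HasK₁₁Link G
    cut-case cut =
      [ (λ one → centred (star⇒sameLink G {linkSide G} cut one))
      , (λ one → centred (star⇒sameLink G {not ∘ linkSide G} (IsCut-not {σ = linkSide G} cut) one)) ]′
      (product-extremal (count (linkSide G)) (count (not ∘ linkSide G))
                        (count+count-not (linkSide G)) (trans (sym (cutLink⇒oddCount G {linkSide G} cut)) τ≡))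
    shifted : (∃₂ λ c x → c < x × SameLink G (K₁₁ (suc c) (suc x))) → HasK₁₁Link G
    shifted (c , x , c<x , same) = suc c , suc x , FinP.<⇒≢ (s≤s c<x) , same
    positive⇒≥m : 1 ≤ oddCount (deleteZero G) → m ≤ oddCount (deleteZero G)
    positive⇒≥m odd≥1 =
      [ (λ even → ⊥-elim (ℕP.<⇒≢ odd≥1 (sym even))) , (λ m≤τ → m≤τ) ]′ (oddCount-lowerBound (deleteZero G))
    odd-case : 1 ≤ oddCount (deleteZero G) × 1 ≤ linkCount G → HasK₁₁Link G
    odd-case (odd≥1 , link≥1) = shifted (edge⇒sameLink G (tight-sum⇒≡1 link≥1 (positive⇒≥m odd≥1) τ≡))

  sameGraph-from-< : ∀ {n} (G H : Graph n) → (∀ v w → v < w → adj G v w ≡ adj H v w) → SameGraph G H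
  sameGraph-from-< G H agree v w with FinP.<-cmp v w
  ... | tri< v<w _ _ = agree v w v<w
  ... | tri≈ _ refl _ = trans (irrefl G v) (sym (irrefl H v))
  ... | tri> _ _ w<v = trans (Graph.sym G v w) (trans (agree w v w<v) (Graph.sym H w v))

  -- Switching at the vertices where the neighbourhoods of 0 differ makes them agree;
  -- a shared link then forces agreement everywhere else.
  sameLink⇒switchingEquivalent : ∀ {n} (H G : Graph (suc n)) → SameLink H G → SwitchingEquivalent H G
  sameLink⇒switchingEquivalent {n} H G same = U , sameGraph-from-< (switch H U) G agree
    where
    U : Fin (suc n) → Bool
    U v = adj H zero v xor adj G zero v
    through-zero : ∀ a g → a xor ((false xor false) xor (a xor g)) ≡ g
    through-zero = solve 2 (λ a g → (a ⊕ ((Κ false ⊕ Κ false) ⊕ (a ⊕ g))) ⊜ g) refl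
    transfer : ∀ a b c a′ b′ c′ → a xor (b xor c) ≡ a′ xor (b′ xor c′) →
      b xor ((a xor a′) xor (c xor c′)) ≡ b′
    transfer a b c a′ b′ c′ e = begin
      b xor ((a xor a′) xor (c xor c′))      ≡⟨ regroup a b c a′ c′ ⟩
      (a xor (b xor c)) xor (a′ xor c′)      ≡⟨ cong (_xor (a′ xor c′)) e ⟩
      (a′ xor (b′ xor c′)) xor (a′ xor c′)   ≡⟨ cancel a′ b′ c′ ⟩
      b′                                     ∎
      where
      open ≡-Reasoning
      regroup : ∀ a b c a′ c′ → b xor ((a xor a′) xor (c xor c′)) ≡ (a xor (b xor c)) xor (a′ xor c′)
      regroup = solve 5 (λ a b c a′ c′ → (b ⊕ ((a ⊕ a′) ⊕ (c ⊕ c′))) ⊜ ((a ⊕ (b ⊕ c)) ⊕ (a′ ⊕ c′))) refl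
      cancel : ∀ a′ b′ c′ → (a′ xor (b′ xor c′)) xor (a′ xor c′) ≡ b′
      cancel = solve 3 (λ a′ b′ c′ → ((a′ ⊕ (b′ ⊕ c′)) ⊕ (a′ ⊕ c′)) ⊜ b′) refl
    agree : ∀ v w → v < w → adj (switch H U) v w ≡ adj G v w
    agree zero (suc j) _ rewrite irrefl H zero | irrefl G zero =
      through-zero (adj H zero (suc j)) (adj G zero (suc j))
    agree (suc i) (suc j) (s≤s i<j) =
      transfer (adj H zero (suc i)) (adj H (suc i) (suc j)) (adj H zero (suc j))
               (adj G zero (suc i)) (adj G (suc i) (suc j)) (adj G zero (suc j)) (same i j i<j)

  permute-injective : ∀ {n} (π : Permutation′ n) {i j} → π ⟨$⟩ʳ i ≡ π ⟨$⟩ʳ j → i ≡ j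
  permute-injective π e = trans (sym (Perm.inverseˡ π)) (trans (cong (π ⟨$⟩ˡ_) e) (Perm.inverseˡ π))

  does-permute : ∀ {n} (π : Permutation′ n) i j → does (π ⟨$⟩ʳ i ≟ π ⟨$⟩ʳ j) ≡ does (i ≟ j)
  does-permute π i j = does-⇔ (mk⇔ (permute-injective π) (cong (π ⟨$⟩ʳ_))) (π ⟨$⟩ʳ i ≟ π ⟨$⟩ʳ j) (i ≟ j)

  K₁₁-permute : ∀ {n} (π : Permutation′ n) a b i j →
    adj (K₁₁ (π ⟨$⟩ʳ a) (π ⟨$⟩ʳ b)) (π ⟨$⟩ʳ i) (π ⟨$⟩ʳ j) ≡ adj (K₁₁ a b) i j
  K₁₁-permute π a b i j
    rewrite does-permute π i a | does-permute π i b | does-permute π j a | does-permute π j b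
          | does-permute π i j = refl

  permutation-01 : ∀ {n} {a b : Fin (suc (suc n))} → a ≢ b →
    Σ (Permutation′ (suc (suc n))) λ π → π ⟨$⟩ʳ zero ≡ a × π ⟨$⟩ʳ suc zero ≡ b
  permutation-01 {a = a} a≢b =
    insert zero a (insert zero (punchOut a≢b) Perm.id) , refl ,
    trans (insert-punchIn zero a (insert zero (punchOut a≢b) Perm.id) zero) (FinP.punchIn-punchOut a≢b)

  K₁₁-isomorphic : ∀ {n} {a b : Fin (suc (suc n))} → a ≢ b → Isomorphic (K₁₁ a b) (K₁₁ zero (suc zero))
  K₁₁-isomorphic a≢b with permutation-01 a≢b
  ... | π , refl , refl = π , K₁₁-permute π zero (suc zero)

  K₁₁-part : ∀ {m} → Fin (3 + m) → Fin 3
  K₁₁-part zero             = zero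
  K₁₁-part (suc zero)       = suc zero
  K₁₁-part (suc (suc _))    = suc (suc zero)

  K₁₁-adj-part : ∀ {m} (v w : Fin (3 + m)) →
    adj (K₁₁ zero (suc zero)) v w ≡ not (does (K₁₁-part v ≟ K₁₁-part w))
  K₁₁-adj-part zero             zero             = refl
  K₁₁-adj-part zero             (suc zero)       = refl
  K₁₁-adj-part zero             (suc (suc _))    = refl
  K₁₁-adj-part (suc zero)       zero             = refl
  K₁₁-adj-part (suc zero)       (suc zero)       = refl
  K₁₁-adj-part (suc zero)       (suc (suc _))    = refl
  K₁₁-adj-part (suc (suc _))    zero             = refl
  K₁₁-adj-part (suc (suc _))    (suc zero)       = refl
  K₁₁-adj-part (suc (suc _))    (suc (suc _))    = refl

  K₁₁-tripartite : ∀ m → CompleteTripartite (K₁₁ {3 + m} zero (suc zero))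
  K₁₁-tripartite m = K₁₁-part , part-surjective , adjacent⇒apart , apart⇒adjacent
    where
    part-surjective : ∀ y → Σ (Fin (3 + m)) λ v → ∀ {w} → w ≡ v → K₁₁-part w ≡ y
    part-surjective zero             = zero             , λ { refl → refl }
    part-surjective (suc zero)       = suc zero         , λ { refl → refl }
    part-surjective (suc (suc zero)) = suc (suc zero)   , λ { refl → refl }
    adjacent⇒apart : ∀ v w → adj (K₁₁ zero (suc zero)) v w ≡ true → K₁₁-part v ≢ K₁₁-part w
    adjacent⇒apart v w adjacent same-part =
      BoolP.not-¬ (sym (dec-true (K₁₁-part v ≟ K₁₁-part w) same-part))
                  (sym (trans (sym (K₁₁-adj-part v w)) adjacent))
    apart⇒adjacent : ∀ v w → K₁₁-part v ≢ K₁₁-part w → adj (K₁₁ zero (suc zero)) v w ≡ true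
    apart⇒adjacent v w apart = trans (K₁₁-adj-part v w) (cong not (dec-false (K₁₁-part v ≟ K₁₁-part w) apart))

  oddCount-K₁₁ : ∀ m → oddCount (K₁₁ {3 + m} zero (suc zero)) ≡ suc m
  oddCount-K₁₁ m = begin
    oddCount (K₁₁ {3 + m} zero (suc zero)) ≡⟨ cutLink⇒oddCount (K₁₁ zero (suc zero)) {σ} star ⟩
    count σ * count (not ∘ σ)        ≡⟨ cong₂ _*_ single rest ⟩
    1 * suc m                        ≡⟨ ℕP.*-identityˡ (suc m) ⟩
    suc m                            ∎
    where
    open ≡-Reasoning
    σ : Fin (2 + m) → Bool
    σ i = does (i ≟ zero)
    star : IsCut (link (K₁₁ zero (suc zero))) σ
    star i j i<j = link-K₁₁-star zero i j (FinP.<⇒≢ i<j)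
    single : count σ ≡ 1
    single = cong suc (sum-replicate-zero (suc m))
    rest : count (not ∘ σ) ≡ suc m
    rest = ℕP.suc-injective (trans (cong (_+ count (not ∘ σ)) (sym single)) (count+count-not σ))

open SeidelInvariant using (oddCount-spectral)
open TwoGraph
  using ( K₁₁; HasK₁₁Link; K₁₁-tripartite; K₁₁-isomorphic; oddCount-K₁₁; oddCount-extremal
        ; sameLink⇒switchingEquivalent)

K₁₁-SDetermined : ∀ m → SDetermined (K₁₁ {3 ℕ.+ m} zero (suc zero))
K₁₁-SDetermined m H cospectral = switchingClass (oddCount-extremal H odd-count)
  where
  odd-count : oddCount H ≡ suc m
  odd-count = trans (oddCount-spectral H (K₁₁ zero (suc zero)) cospectral (s≤s (s≤s (s≤s z≤n)))) (oddCount-K₁₁ m)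
  switchingClass : HasK₁₁Link H →
    Σ (Graph (3 ℕ.+ m)) λ G′ → SwitchingEquivalent H G′ × Isomorphic G′ (K₁₁ zero (suc zero))
  switchingClass (a , b , a≢b , same) =
    K₁₁ a b , sameLink⇒switchingEquivalent H (K₁₁ a b) same , K₁₁-isomorphic a≢b

corollary4p9 : ∀ (n : ℕ) → n ≥ 3 →
    Σ (Graph n) λ G → CompleteTripartite G × SDetermined G
corollary4p9 (suc zero)          (s≤s ())
corollary4p9 (suc (suc zero))    (s≤s (s≤s ()))
corollary4p9 (suc (suc (suc m))) _ = K₁₁ zero (suc zero) , K₁₁-tripartite m , K₁₁-SDetermined m
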